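{- Let $d\geq 2$, let $t=k_1\cdot x_1+\dots+k_r\cdot x_r$ be a homogeneous term and $c\in\mathbb Z$. Then the DWA $\mathcal A^{d\mid t+c}$ represents $\{\bar a\in\mathbb Z^r: d\mid t[\bar a]+c\}$ and has $d+1$ states.
   Context: Fix an integer base $\varrho\geq2$ and $\Sigma=\{0,\dots,\varrho-1\}$. A homogeneous term is $0$ or $k_1\cdot x_1+\dots+k_r\cdot x_r$ with distinct variables and nonzero integer $k_i$; $t[\bar a]=\sum k_ia_i$. $\operatorname{rem}(q,d)\in\{0,\dots,d-1\}$ is the remainder of $q$ divided by $d$. A letter $\bar b=(b_1,\dots,b_r)\in\Sigma^r$ is identified with the tuple $(b_1,\dots,b_r)$, and $\sigma(\bar b)=(c_1,\dots,c_r)$ with $c_i=0$ if $b_i=0$, $c_i=-1$ otherwise. $\mathcal A^{d\mid t+c}=(Q,\Sigma^r,\delta,q_I,F)$ with $Q=\{q_I,0,1,\dots,d-1\}$, $\delta(q_I,\bar b)=\operatorname{rem}(t[\sigma(\bar b)],d)$, $\delta(q,\bar b)=\operatorname{rem}(\varrho q+t[\bar b],d)$ for $q\in Q\setminus\{q_I\}$, and $F=\{q\in Q\cap\mathbb Z: d\mid q+c\}$. Encoding: for $b_nb_{n-1}\dots b_0\in\Sigma^+$, $\langle b_n\dots b_0\rangle_{\mathbb Z}=\sum_{i<n}\varrho^ib_i$ if $b_n=0$ and $\sum_{i<n}\varrho^ib_i-\varrho^n$ otherwise; words over $\Sigma^r$ are decoded track by track. A DWA over $\Sigma^r$ represents $U\subseteq\mathbb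 Z^r$ if its language is $\{w\in(\Sigma^r)^+:\langle w\rangle_{\mathbb Z}\in U\}$. -}

module Defs where

open import Data.Nat as ℕ using (ℕ; zero; suc; NonZero)
open import Data.Integer as ℤ using (ℤ; +_; 0ℤ; -1ℤ)
open import Data.Integer.DivMod using (_%ℕ_; n%ℕd<d)
open import Data.Integer.Divisibility as ℤD using ()
open import Data.Fin as Fin using (Fin; toℕ; fromℕ<)
open import Data.Vec as Vec using (Vec; lookup; tabulate; zipWith; foldr)
open import Data.List as List using (List; []; _∷_; length; reverse; foldl)
open import Data.List.NonEmpty as List⁺ using (List⁺; _∷_; toList)
open import Data.Empty using (⊥)

Letter : ℕ → ℕ → Set
Letter ϱ r = Vec (Fin ϱ) r

-- Words in (Σ^r)^+ ; the head is the leftmost (most significant, sign) letter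
Word : ℕ → ℕ → Set
Word ϱ r = List⁺ (Letter ϱ r)

evalTerm : ∀ {r} → Vec ℤ r → Vec ℤ r → ℤ
evalTerm k a = foldr _ ℤ._+_ 0ℤ (zipWith ℤ._*_ k a)

letterℤ : ∀ {ϱ r} → Letter ϱ r → Vec ℤ r
letterℤ b = Vec.map (λ x → + toℕ x) b

σ : ∀ {ϱ r} → Letter ϱ r → Vec ℤ r
σ b = Vec.map (λ x → sg (toℕ x)) b
  where
  sg : ℕ → ℤ
  sg zero    = 0ℤ
  sg (suc _) = -1ℤ

rem : ℤ → (d : ℕ) .{{_ : NonZero d}} → Fin d
rem q d = fromℕ< (n%ℕd<d q d)

valLSB : ℕ → List ℕ → ℕ
valLSB ϱ []       = 0
valLSB ϱ (b ∷ bs) = b ℕ.+ ϱ ℕ.* valLSB ϱ bs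

decodeℤ : ∀ {ϱ} → List⁺ (Fin ϱ) → ℤ
decodeℤ {ϱ} (bn ∷ rest) with toℕ bn
... | zero  = + valLSB ϱ (reverse (List.map toℕ rest))
... | suc _ = + valLSB ϱ (reverse (List.map toℕ rest)) ℤ.- + (ϱ ℕ.^ length rest)

decode : ∀ {ϱ r} → Word ϱ r → Vec ℤ r
decode {r = r} w = tabulate λ i → decodeℤ (List⁺.map (λ b → lookup b i) w)

record DWA (A : Set) : Set₁ where
  field
    nStates : ℕ
    δ       : Fin nStates → A → Fin nStates
    qI      : Fin nStates
    F       : Fin nStates → Set

  run : List A → Fin nStates
  run = foldl δ qI

  Accepts : List⁺ A → Set
  Accepts w = F (run (toList w))

open DWA public

Represents : ∀ {ϱ r} → DWA (Letter ϱ r) → (Vec ℤ r → Set) → Set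
Represents A U = ∀ w → (Accepts A w → U (decode w)) × (U (decode w) → Accepts A w)
  where open import Data.Product using (_×_)

-- The automaton A^{d | t+c}.  States: Fin (suc d), where zero = q_I and
-- suc q stands for the integer state q ∈ {0,…,d-1}.
A-div : (ϱ d : ℕ) .{{_ : NonZero d}} → ∀ {r} → (k : Vec ℤ r) → (c : ℤ) → DWA (Letter ϱ r)
A-div ϱ d k c = record { nStates = suc d ; δ = δ' ; qI = zero' ; F = F' }
  where
  zero' : Fin (suc d)
  zero' = Fin.zero
  δ' : Fin (suc d) → Letter ϱ _ → Fin (suc d)
  δ' Fin.zero    b = Fin.suc (rem (evalTerm k (σ b)) d)
  δ' (Fin.suc q) b = Fin.suc (rem (+ ϱ ℤ.* + toℕ q ℤ.+ evalTerm k (letterℤ b)) d)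
  F' : Fin (suc d) → Set
  F' Fin.zero    = ⊥
  F' (Fin.suc q) = (+ d) ℤD.∣ (+ toℕ q ℤ.+ c)

{-# OPTIONS --safe #-}
-- Appending a letter b̄ to a word w maps each track value aᵢ to ϱ·aᵢ + bᵢ, so by linearity
-- t[⟨w b̄⟩] = ϱ·t[⟨w⟩] + t[b̄]; a one-letter word decodes to σ(b̄). These are exactly the
-- updates performed by δ modulo d, so after reading w the automaton is in an integer state
-- q ≡ t[⟨w⟩] (mod d), and it accepts iff d ∣ q + c iff d ∣ t[⟨w⟩] + c.
module Submission where

open import Defs
open import Data.Nat using (ℕ; suc; _≤_; NonZero)
open import Data.Integer using (ℤ; +_; 0ℤ; _+_)
open import Data.Integer.Divisibility using (_∣_)
open import Data.Vec using (Vec; lookup)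
open import Data.Fin using (Fin)
open import Data.Product using (_×_)
open import Relation.Binary.PropositionalEquality using (_≡_; _≢_)

open import Data.Nat as ℕ using (zero)
import Data.Nat.Properties as ℕP
open import Data.Integer using (_*_; _-_; -_)
import Data.Integer.Properties as ℤP
open import Data.Integer.DivMod using (_%ℕ_; _/ℕ_; a≡a%ℕn+[a/ℕn]*n)
import Data.Integer.Divisibility.Signed as Signed
open import Data.Integer.Tactic.RingSolver using (solve-∀)
open import Data.Fin using (toℕ)
import Data.Fin.Properties as FinP
import Data.Vec as Vec
open import Data.Vec using ([]; _∷_; zipWith)
import Data.Vec.Properties as VecP
open import Data.List as List using (List; [_]; _∷ʳ_; reverse; length)
import Data.List.Properties as ListP
open import Data.List.NonEmpty using (_∷_)
open import Data.List.Reverse using (Reverse; []; _∶_∶ʳ_; reverseView)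
open import Data.Product using (_,_; ∃-syntax)
open import Relation.Binary.PropositionalEquality
  using (refl; sym; trans; cong; cong₂; subst; module ≡-Reasoning)
open ≡-Reasoning

valLSB-reverse-∷ʳ : ∀ ϱ (ns : List ℕ) n →
  valLSB ϱ (reverse (ns ∷ʳ n)) ≡ n ℕ.+ ϱ ℕ.* valLSB ϱ (reverse ns)
valLSB-reverse-∷ʳ ϱ ns n = cong (valLSB ϱ) (ListP.reverse-++ ns [ n ])

valLSB-digits-∷ʳ : ∀ {ϱ} (xs : List (Fin ϱ)) (y : Fin ϱ) →
  + valLSB ϱ (reverse (List.map toℕ (xs ∷ʳ y)))
    ≡ + ϱ * + valLSB ϱ (reverse (List.map toℕ xs)) + + toℕ y
valLSB-digits-∷ʳ {ϱ} xs y = begin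
  + valLSB ϱ (reverse (List.map toℕ (xs ∷ʳ y)))
    ≡⟨ cong (λ ns → + valLSB ϱ (reverse ns)) (ListP.map-++ toℕ xs [ y ]) ⟩
  + valLSB ϱ (reverse (List.map toℕ xs ∷ʳ toℕ y))
    ≡⟨ cong +_ (valLSB-reverse-∷ʳ ϱ (List.map toℕ xs) (toℕ y)) ⟩
  + (toℕ y ℕ.+ ϱ ℕ.* v)
    ≡⟨ ℤP.pos-+ (toℕ y) (ϱ ℕ.* v) ⟩
  + toℕ y + + (ϱ ℕ.* v)
    ≡⟨ cong (_+_ (+ toℕ y)) (ℤP.pos-* ϱ v) ⟩
  + toℕ y + + ϱ * + v
    ≡⟨ ℤP.+-comm (+ toℕ y) (+ ϱ * + v) ⟩
  + ϱ * + v + + toℕ y ∎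
  where
  v : ℕ
  v = valLSB ϱ (reverse (List.map toℕ xs))

decodeℤ-∷ʳ : ∀ {ϱ} (x : Fin ϱ) (xs : List (Fin ϱ)) (y : Fin ϱ) →
  decodeℤ (x ∷ (xs ∷ʳ y)) ≡ + ϱ * decodeℤ (x ∷ xs) + + toℕ y
decodeℤ-∷ʳ {ϱ} x xs y with toℕ x
... | zero  = valLSB-digits-∷ʳ xs y
... | suc _ = begin
  + valLSB ϱ (reverse (List.map toℕ (xs ∷ʳ y))) - + (ϱ ℕ.^ length (xs ∷ʳ y))
    ≡⟨ cong₂ _-_ (valLSB-digits-∷ʳ xs y) power-∷ʳ ⟩
  (+ ϱ * v + + toℕ y) - + ϱ * + (ϱ ℕ.^ length xs)
    ≡⟨ distrib (+ ϱ) v (+ toℕ y) (+ (ϱ ℕ.^ length xs)) ⟩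
  + ϱ * (v - + (ϱ ℕ.^ length xs)) + + toℕ y ∎
  where
  v : ℤ
  v = + valLSB ϱ (reverse (List.map toℕ xs))
  power-∷ʳ : + (ϱ ℕ.^ length (xs ∷ʳ y)) ≡ + ϱ * + (ϱ ℕ.^ length xs)
  power-∷ʳ = trans (cong (λ n → + (ϱ ℕ.^ n)) (trans (ListP.length-++ xs) (ℕP.+-comm (length xs) 1)))
                   (ℤP.pos-* ϱ (ϱ ℕ.^ length xs))
  distrib : ∀ R a b p → (R * a + b) - R * p ≡ R * (a - p) + b
  distrib = solve-∀

decodeℤ-singleton : ∀ {ϱ} (x : Fin ϱ) → decodeℤ (x ∷ List.[]) ≡ lookup (σ (x ∷ [])) Fin.zero
decodeℤ-singleton x with toℕ x
... | zero  = refl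
... | suc _ = refl

decode-singleton : ∀ {ϱ r} (L : Letter ϱ r) → decode (L ∷ List.[]) ≡ σ L
decode-singleton L = trans (VecP.tabulate-cong track) (VecP.tabulate∘lookup (σ L))
  where
  track : ∀ i → decodeℤ (lookup L i ∷ List.[]) ≡ lookup (σ L) i
  track i = trans (decodeℤ-singleton (lookup L i)) (sym (VecP.lookup-map i _ L))

decode-∷ʳ : ∀ {ϱ r} (L : Letter ϱ r) (rest : List (Letter ϱ r)) (b : Letter ϱ r) →
  decode (L ∷ (rest ∷ʳ b)) ≡ zipWith _+_ (Vec.map (+ ϱ *_) (decode (L ∷ rest))) (letterℤ b)
decode-∷ʳ {ϱ} L rest b = trans (VecP.tabulate-cong track) (VecP.tabulate∘lookup _)
  where
  column : ∀ i → List (Fin ϱ)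
  column i = List.map (λ l → lookup l i) rest
  track : ∀ i → decodeℤ (lookup L i ∷ List.map (λ l → lookup l i) (rest ∷ʳ b))
              ≡ lookup (zipWith _+_ (Vec.map (+ ϱ *_) (decode (L ∷ rest))) (letterℤ b)) i
  track i = begin
    decodeℤ (lookup L i ∷ List.map (λ l → lookup l i) (rest ∷ʳ b))
      ≡⟨ cong (λ ds → decodeℤ (lookup L i ∷ ds)) (ListP.map-++ _ rest [ b ]) ⟩
    decodeℤ (lookup L i ∷ (column i ∷ʳ lookup b i))
      ≡⟨ decodeℤ-∷ʳ (lookup L i) (column i) (lookup b i) ⟩
    + ϱ * decodeℤ (lookup L i ∷ column i) + + toℕ (lookup b i)
      ≡⟨ cong₂ (λ a y → + ϱ * a + y)
               (sym (VecP.lookup∘tabulate _ i)) (sym (VecP.lookup-map i _ b)) ⟩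
    + ϱ * lookup (decode (L ∷ rest)) i + lookup (letterℤ b) i
      ≡⟨ cong (_+ lookup (letterℤ b) i) (sym (VecP.lookup-map i _ (decode (L ∷ rest)))) ⟩
    lookup (Vec.map (+ ϱ *_) (decode (L ∷ rest))) i + lookup (letterℤ b) i
      ≡⟨ VecP.lookup-zipWith _+_ i (Vec.map (+ ϱ *_) (decode (L ∷ rest))) (letterℤ b) ⟨
    lookup (zipWith _+_ (Vec.map (+ ϱ *_) (decode (L ∷ rest))) (letterℤ b)) i ∎

evalTerm-zipWith-+ : ∀ {r} (k u v : Vec ℤ r) →
  evalTerm k (zipWith _+_ u v) ≡ evalTerm k u + evalTerm k v
evalTerm-zipWith-+ [] [] [] = refl
evalTerm-zipWith-+ (k ∷ ks) (u ∷ us) (v ∷ vs) = begin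
  k * (u + v) + evalTerm ks (zipWith _+_ us vs)
    ≡⟨ cong (_+_ (k * (u + v))) (evalTerm-zipWith-+ ks us vs) ⟩
  k * (u + v) + (evalTerm ks us + evalTerm ks vs)
    ≡⟨ regroup k u v (evalTerm ks us) (evalTerm ks vs) ⟩
  (k * u + evalTerm ks us) + (k * v + evalTerm ks vs) ∎
  where
  regroup : ∀ k u v s t → k * (u + v) + (s + t) ≡ (k * u + s) + (k * v + t)
  regroup = solve-∀

evalTerm-map-* : ∀ {r} (R : ℤ) (k u : Vec ℤ r) →
  evalTerm k (Vec.map (R *_) u) ≡ R * evalTerm k u
evalTerm-map-* R [] [] = sym (ℤP.*-zeroʳ R)
evalTerm-map-* R (k ∷ ks) (u ∷ us) = begin
  k * (R * u) + evalTerm ks (Vec.map (R *_) us)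
    ≡⟨ cong (_+_ (k * (R * u))) (evalTerm-map-* R ks us) ⟩
  k * (R * u) + R * evalTerm ks us
    ≡⟨ factor R k u (evalTerm ks us) ⟩
  R * (k * u + evalTerm ks us) ∎
  where
  factor : ∀ R k u s → k * (R * u) + R * s ≡ R * (k * u + s)
  factor = solve-∀

evalTerm-decode-∷ʳ : ∀ {ϱ r} (k : Vec ℤ r) (L : Letter ϱ r) (rest : List (Letter ϱ r)) (b : Letter ϱ r) →
  evalTerm k (decode (L ∷ (rest ∷ʳ b)))
    ≡ + ϱ * evalTerm k (decode (L ∷ rest)) + evalTerm k (letterℤ b)
evalTerm-decode-∷ʳ {ϱ} k L rest b = begin
  evalTerm k (decode (L ∷ (rest ∷ʳ b)))
    ≡⟨ cong (evalTerm k) (decode-∷ʳ L rest b) ⟩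
  evalTerm k (zipWith _+_ (Vec.map (+ ϱ *_) (decode (L ∷ rest))) (letterℤ b))
    ≡⟨ evalTerm-zipWith-+ k _ (letterℤ b) ⟩
  evalTerm k (Vec.map (+ ϱ *_) (decode (L ∷ rest))) + evalTerm k (letterℤ b)
    ≡⟨ cong (_+ evalTerm k (letterℤ b)) (evalTerm-map-* (+ ϱ) k (decode (L ∷ rest))) ⟩
  + ϱ * evalTerm k (decode (L ∷ rest)) + evalTerm k (letterℤ b) ∎

infix 4 _≡_[mod_]
record _≡_[mod_] (a b : ℤ) (d : ℕ) : Set where
  constructor ≡mod
  field divides-difference : + d Signed.∣ a - b

module _ {d : ℕ} where

  ≡mod-sym : ∀ {a b} → a ≡ b [mod d ] → b ≡ a [mod d ]
  ≡mod-sym {a} {b} (≡mod d∣a-b) = ≡mod (subst (+ d Signed.∣_) (swap a b) (Signed.∣m⇒∣-m d∣a-b))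
    where
    swap : ∀ a b → - (a - b) ≡ b - a
    swap = solve-∀

  ≡mod-trans : ∀ {a b e} → a ≡ b [mod d ] → b ≡ e [mod d ] → a ≡ e [mod d ]
  ≡mod-trans {a} {b} {e} (≡mod d∣a-b) (≡mod d∣b-e) =
    ≡mod (subst (+ d Signed.∣_) (telescope a b e) (Signed.∣m∣n⇒∣m+n d∣a-b d∣b-e))
    where
    telescope : ∀ a b e → (a - b) + (b - e) ≡ a - e
    telescope = solve-∀

  ≡mod-+ʳ : ∀ {a b} c → a ≡ b [mod d ] → a + c ≡ b + c [mod d ]
  ≡mod-+ʳ {a} {b} c (≡mod d∣a-b) = ≡mod (subst (+ d Signed.∣_) (cancel a b c) d∣a-b)
    where
    cancel : ∀ a b c → a - b ≡ (a + c) - (b + c)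
    cancel = solve-∀

  ≡mod-*ˡ : ∀ {a b} R → a ≡ b [mod d ] → R * a ≡ R * b [mod d ]
  ≡mod-*ˡ {a} {b} R (≡mod d∣a-b) = ≡mod (subst (+ d Signed.∣_) (distrib R a b) (Signed.∣n⇒∣m*n R d∣a-b))
    where
    distrib : ∀ R a b → R * (a - b) ≡ R * a - R * b
    distrib = solve-∀

  ∣-respects-≡mod : ∀ {a b} → a ≡ b [mod d ] → + d ∣ a → + d ∣ b
  ∣-respects-≡mod {a} {b} (≡mod d∣a-b) d∣a =
    Signed.∣⇒∣ᵤ (subst (+ d Signed.∣_) (cancel a b) (Signed.∣m∣n⇒∣m-n {m = a} (Signed.∣ᵤ⇒∣ d∣a) d∣a-b))
    where
    cancel : ∀ a b → a - (a - b) ≡ b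
    cancel = solve-∀

rem-≡mod : ∀ e d .{{_ : NonZero d}} → + toℕ (rem e d) ≡ e [mod d ]
rem-≡mod e d = ≡mod (Signed.divides (- (e /ℕ d)) (begin
  + toℕ (rem e d) - e                          ≡⟨ cong (λ m → + m - e) (FinP.toℕ-fromℕ< _) ⟩
  + (e %ℕ d) - e                               ≡⟨ cong (_-_ (+ (e %ℕ d))) (a≡a%ℕn+[a/ℕn]*n e d) ⟩
  + (e %ℕ d) - (+ (e %ℕ d) + (e /ℕ d) * + d)   ≡⟨ cancel (+ (e %ℕ d)) (e /ℕ d) (+ d) ⟩
  - (e /ℕ d) * + d                             ∎))
  where
  cancel : ∀ m q D → m - (m + q * D) ≡ - q * D
  cancel = solve-∀

module _ (ϱ d : ℕ) .{{_ : NonZero d}} {r : ℕ} (k : Vec ℤ r) (c : ℤ) where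

  private
    A : DWA (Letter ϱ r)
    A = A-div ϱ d k c

  run-A-div-≡mod : (L : Letter ϱ r) {rest : List (Letter ϱ r)} → Reverse rest →
    ∃[ q ] run A (L List.∷ rest) ≡ Fin.suc q
         × (+ toℕ q ≡ evalTerm k (decode (L ∷ rest)) [mod d ])
  run-A-div-≡mod L [] =
    rem (evalTerm k (σ L)) d , refl ,
    subst (λ a → + toℕ (rem (evalTerm k (σ L)) d) ≡ evalTerm k a [mod d ])
          (sym (decode-singleton L)) (rem-≡mod (evalTerm k (σ L)) d)
  run-A-div-≡mod L (rest ∶ view ∶ʳ b) with run-A-div-≡mod L view
  ... | q , run≡q , q≡t = rem x d , run≡ , rem≡t
    where
    x : ℤ
    x = + ϱ * + toℕ q + evalTerm k (letterℤ b)
    run≡ : run A (L List.∷ (rest ∷ʳ b)) ≡ Fin.suc (rem x d)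
    run≡ = trans (ListP.foldl-∷ʳ (δ A) (δ A (qI A) L) b rest) (cong (λ s → δ A s b) run≡q)
    rem≡t : + toℕ (rem x d) ≡ evalTerm k (decode (L ∷ (rest ∷ʳ b))) [mod d ]
    rem≡t = subst (λ e → + toℕ (rem x d) ≡ e [mod d ]) (sym (evalTerm-decode-∷ʳ k L rest b))
              (≡mod-trans (rem-≡mod x d) (≡mod-+ʳ _ (≡mod-*ˡ (+ ϱ) q≡t)))

  A-div-represents : Represents A (λ a → + d ∣ evalTerm k a + c)
  A-div-represents (L ∷ rest) with run-A-div-≡mod L (reverseView rest)
  ... | q , run≡q , q≡t =
    (λ acc → ∣-respects-≡mod q+c≡t+c (subst (F A) run≡q acc)) ,
    (λ d∣t+c → subst (F A) (sym run≡q) (∣-respects-≡mod (≡mod-sym q+c≡t+c) d∣t+c))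
    where
    q+c≡t+c : + toℕ q + c ≡ evalTerm k (decode (L ∷ rest)) + c [mod d ]
    q+c≡t+c = ≡mod-+ʳ c q≡t

-- The construction needs none of 2 ≤ ϱ, 2 ≤ d and kᵢ ≠ 0.
lemma3p11 : (ϱ : ℕ) → 2 ≤ ϱ → (d : ℕ) .{{_ : NonZero d}} → 2 ≤ d →
    (r : ℕ) (k : Vec ℤ r) → (∀ (i : Fin r) → lookup k i ≢ 0ℤ) → (c : ℤ) →
    Represents (A-div ϱ d k c) (λ a → (+ d) ∣ (evalTerm k a + c))
    × nStates (A-div ϱ d k c) ≡ suc d
lemma3p11 ϱ _ d _ r k _ c = A-div-represents ϱ d k c , refl
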